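{- In the root system $\Phi$ of type $E_8$, let $U$ be the set of positive roots of $8$-height $1$, let $U'$ be the set of positive roots of $8$-height $0$ and $7$-height $1$, and let $\eta=\theta-\alpha_8$. (i) $s_8$ restricts to a bijection from $U'$ to $\eta_U^\perp:=\{\beta\in U:B(\beta,\eta)=0\}$. (ii) Each element of $\Omega_{U'}$ has size $3$. (iii) The map $\iota:\Omega_{U'}\to\Omega_U$, $\iota(\{\beta_1,\beta_2,\beta_3\})=\{s_8(\beta_1),s_8(\beta_2),s_8(\beta_3),\eta\}$, is well defined, injective, and $W(E_6)$-equivariant, where $W(E_6)=\langle s_1,\dots,s_6\rangle$ acts by the standard action. (iv) For distinct $\beta,\gamma\in U'$, $s_\beta(\gamma)<0$ if and only if $s_{s_8(\beta)}(s_8(\gamma))<0$. (v) For every $T\in\Omega_{U'}$, $\gamma\mapsto s_8(\gamma)$ is a bijection $\mathrm{Res}_{U'}(T)\to\mathrm{Res}_U(\iota(T))$; in particular $\rho_{U'}(T)=\rho_U(\iota(T))$.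
   Context: $\Phi$ is the root system of type $E_8$ with simple roots $\alpha_1,\dots,\alpha_8$ labelled so that $\alpha_1,\alpha_3,\alpha_4,\dots,\alpha_8$ form a path in this order and $\alpha_2$ is joined only to $\alpha_4$; invariant form $B$; $s_\beta(\gamma)=\gamma-B(\beta,\gamma)\beta$, $s_i=s_{\alpha_i}$; $\gamma<0$ means $\gamma$ is a negative root. The $i$-height of a root is its $\alpha_i$-coefficient; $\theta$ is the highest root. For a root $\alpha$, $|\alpha|$ is the positive root among $\pm\alpha$; the standard action is $w\cdot R=\{|w(\alpha)|:\alpha\in R\}$. For $V\subseteq\Phi_+$, $\Omega_V$ is the set of pairwise orthogonal subsets of $V$ of maximal cardinality, $\mathrm{Res}_V(R)=\{\gamma\in V:s_\beta(\gamma)\in\Phi_+\ \forall\beta\in R\}$, and $\rho_V(R)=|\mathrm{Res}_V(R)|$. -}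

module Defs where

open import Data.Nat using (ℕ; _≤_)
import Data.Nat
import Data.Fin
import Data.Integer
open import Data.Integer using (ℤ; +_; -_; _+_; _-_; _*_; 0ℤ; 1ℤ) renaming (_≤_ to _≤ℤ_)
open import Data.Fin using (Fin; zero; suc)
open import Data.Vec using (Vec; []; _∷_; lookup; map; zipWith; foldr; allFin)
open import Data.List using (List; length; _∷ʳ_) renaming (map to lmap; [] to l[]; _∷_ to _l∷_)
open import Data.List.Relation.Unary.All using (All)
open import Data.List.Relation.Unary.AllPairs using (AllPairs)
open import Data.List.Relation.Unary.Unique.Propositional using (Unique)
open import Data.List.Membership.Propositional using (_∈_)
open import Data.Product using (Σ; _×_; ∃)
open import Function.Bundles using (_⇔_)
open import Relation.Binary.PropositionalEquality using (_≡_)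
open import Relation.Nullary.Decidable using (Dec; yes; no)
import Data.Vec.Relation.Unary.All as VAll

-- Vectors of coefficients with respect to the simple roots α₁,…,α₈;
-- α_i corresponds to the index i-1 in Fin 8.
Vect : Set
Vect = Vec ℤ 8

-- Cartan matrix (= invariant form B on simple roots) for E8 with the labelling
-- 1-3-4-5-6-7-8 a path and 2 joined to 4.
adj : Fin 8 → Fin 8 → ℤ
adj i j = cart (toN i) (toN j)
  where
  toN : ∀ {n} → Fin n → ℕ
  toN zero = 0
  toN (suc k) = Data.Nat.suc (toN k)
  edge : ℕ → ℕ → ℤ
  edge 0 2 = - 1ℤ
  edge 2 3 = - 1ℤ
  edge 3 4 = - 1ℤ
  edge 4 5 = - 1ℤ
  edge 5 6 = - 1ℤ
  edge 6 7 = - 1ℤ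
  edge 1 3 = - 1ℤ
  edge _ _ = 0ℤ
  cart : ℕ → ℕ → ℤ
  cart m n with Data.Nat._≟_ m n
  ... | yes _ = + 2
  ... | no _ = edge m n + edge n m

sumV : ∀ {n} → Vec ℤ n → ℤ
sumV = foldr _ _+_ 0ℤ

B : Vect → Vect → ℤ
B u v = sumV (map (λ i → lookup u i * sumV (map (λ j → adj i j * lookup v j) (allFin 8))) (allFin 8))

simple : Fin 8 → Vect
simple i = map (λ j → δ i j) (allFin 8)
  where
  δ : ∀ {n} → Fin n → Fin n → ℤ
  δ zero zero = 1ℤ
  δ zero (suc _) = 0ℤ
  δ (suc _) zero = 0ℤ
  δ (suc a) (suc b) = δ a b

_−ᵥ_ : Vect → Vect → Vect
u −ᵥ v = zipWith _-_ u v

_·ᵥ_ : ℤ → Vect → Vect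
c ·ᵥ v = map (c *_) v

negV : Vect → Vect
negV = map (λ c → - c)

refl' : Vect → Vect → Vect
refl' β γ = γ −ᵥ (B β γ ·ᵥ β)

s : Fin 8 → Vect → Vect
s i = refl' (simple i)

s8 : Vect → Vect
s8 = s (Data.Fin.fromℕ 7)

-- Roots of E8: vectors of the root lattice (integer coefficients in the simple
-- roots) of squared length B(v,v) = 2.
IsRoot : Vect → Set
IsRoot v = B v v ≡ + 2

IsPos : Vect → Set
IsPos v = IsRoot v × VAll.All (λ c → 0ℤ ≤ℤ c) v

IsNeg : Vect → Set
IsNeg v = IsRoot v × VAll.All (λ c → c ≤ℤ 0ℤ) v

absV : Vect → Vect
absV v with VAll.all? (λ c → c Data.Integer.≤? 0ℤ) v
... | yes _ = negV v
... | no _ = v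

θ : Vect
θ = + 2 ∷ + 3 ∷ + 4 ∷ + 6 ∷ + 5 ∷ + 4 ∷ + 3 ∷ + 2 ∷ []

η : Vect
η = θ −ᵥ simple (Data.Fin.fromℕ 7)

U : Vect → Set
U v = IsPos v × lookup v (Data.Fin.fromℕ 7) ≡ 1ℤ

U' : Vect → Set
U' v = IsPos v × lookup v (Data.Fin.fromℕ 7) ≡ 0ℤ × lookup v (Data.Fin.inject₁ (Data.Fin.fromℕ 6)) ≡ 1ℤ

ηperpU : Vect → Set
ηperpU v = U v × B v η ≡ 0ℤ

-- Finite subsets are represented by duplicate-free lists.
Orth : Vect → Vect → Set
Orth a b = B a b ≡ 0ℤ

PWOrth : (Vect → Set) → List Vect → Set
PWOrth V S = Unique S × All V S × AllPairs Orth S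

Ω : (Vect → Set) → List Vect → Set
Ω V S = PWOrth V S × (∀ S' → PWOrth V S' → length S' ≤ length S)

_≈ˢ_ : List Vect → List Vect → Set
A ≈ˢ A' = ∀ x → (x ∈ A) ⇔ (x ∈ A')

ι : List Vect → List Vect
ι T = lmap s8 T ∷ʳ η

-- W(E6) = ⟨s₁,…,s₆⟩: elements given by words in the generators s₁..s₆;
-- the word i₁ ∷ … ∷ i_k denotes s_{i₁} ⋯ s_{i_k}.
embed6 : Fin 6 → Fin 8
embed6 i = i Data.Fin.↑ˡ 2

actW : List (Fin 6) → Vect → Vect
actW l[] v = v
actW (i l∷ is) v = s (embed6 i) (actW is v)

_·_ : List (Fin 6) → List Vect → List Vect
w · R = lmap (λ α → absV (actW w α)) R

Res : (Vect → Set) → List Vect → Vect → Set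
Res V R γ = V γ × All (λ β → IsPos (refl' β γ)) R

Enumerates : (Vect → Set) → List Vect → Set
Enumerates P L = Unique L × (∀ x → (x ∈ L) ⇔ P x)

-- ρ_V(R) = n : the set Res_V(R) is finite with n elements
HasCard : (Vect → Set) → ℕ → Set
HasCard P n = Σ (List Vect) (λ L → Enumerates P L × length L ≡ n)

module Submission where

-- Everything is reduced to explicit roots plus general facts about reflections.
-- The form B is positive definite (60 B(v, v) is a sum of squares), so descending
-- along simple reflections shows that every positive root lies in an explicit list
-- of the 120 positive roots of E₈; U and U′ are filtered out of it, and (i), the
-- existence of an orthogonal triple in U′ and the orthogonality to η of the elements
-- of Res_U(ι T) are finite checks on that list. The rest is structural: s₈ is an
-- isometric involution with s_{s₈β}(s₈γ) = s₈(s_β γ), and it preserves the sign of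
-- every root of 8-height 0, which gives (iv) and the bijection of (v); s₁, …, s₆
-- commute with s₈, fix η and preserve U′, which gives equivariance. Finally, for
-- pairwise orthogonal x₁, …, x_k in U the vector 2θ - Σ xᵢ has norm 8 - 2k ≥ 0, so
-- k ≤ 4; since ι adds η, elements of Ω_{U′} have at most 3 elements, hence exactly 3.

open import Defs
open import Data.Nat using (ℕ)
open import Data.Fin using (Fin)
open import Data.List using (List; length)
open import Data.Product using (Σ; _×_; ∃)
open import Function.Bundles using (_⇔_)
open import Relation.Binary.PropositionalEquality using (_≡_)
open import Relation.Nullary using (¬_)

open import Algebra.Bundles.Raw using (RawRing)
open import Data.Fin using (zero; suc; fromℕ; inject₁)
import Data.Fin as Fin
import Data.Fin.Properties as FinP
open import Data.Integer using (ℤ; +_; -[1+_]; 0ℤ; 1ℤ; +-*-rawRing)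
import Data.Integer as ℤ
import Data.Integer.Properties as ℤP
open import Data.Integer.Solver using (module +-*-Solver)
open +-*-Solver using (Polynomial; solve; _:=_; con; _:+_; _:*_; :-_)
open import Data.Integer.Tactic.RingSolver using (solve-∀)
open import Data.List using (_∷_; []; filter; _++_) renaming (map to mapL)
import Data.List.Properties as ListP
open import Data.List.Membership.Propositional using (_∈_)
import Data.List.Membership.Propositional.Properties as ∈P
open import Data.List.Relation.Unary.All as All using (All; []; _∷_)
import Data.List.Relation.Unary.All.Properties as AllP
open import Data.List.Relation.Unary.AllPairs as AllPairs using (AllPairs; []; _∷_)
import Data.List.Relation.Unary.AllPairs.Properties as AllPairsP
open import Data.List.Relation.Unary.Any using (here)
open import Data.List.Relation.Unary.Unique.Propositional using (Unique)
import Data.List.Relation.Unary.Unique.Propositional.Properties as UniqueP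
import Data.Nat as ℕ
import Data.Nat.Induction as ℕInd
import Data.Nat.Properties as ℕP
open import Data.Product using (_,_; proj₁; proj₂)
open import Data.Sum using (_⊎_; inj₁; inj₂)
open import Data.Unit using (tt)
open import Data.Vec using (Vec; _∷_; []; lookup; map; zipWith; foldr; allFin; tabulate; replicate; _[_]≔_)
import Data.Vec.Properties as VecP
import Data.Vec.Relation.Unary.All as VAll
open VAll using ([]; _∷_)
import Data.Vec.Relation.Unary.All.Properties as VAllP
open import Function using (id; _∘_)
open import Function.Bundles using (Equivalence; mk⇔)
open import Function.Properties.Equivalence using () renaming (refl to ⇔-refl; sym to ⇔-sym; trans to ⇔-trans)
open import Induction.WellFounded using (Acc; acc)
open import Level using (0ℓ)
open import Relation.Binary.Definitions using (DecidableEquality)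
open import Relation.Binary.PropositionalEquality using (_≢_; refl; sym; trans; cong; cong₂; subst; subst₂; module ≡-Reasoning)
open import Relation.Nullary using (contradiction)
open import Relation.Nullary.Decidable using (Dec; yes; no; toWitness; map′; _×-dec_; _⊎-dec_; _→-dec_)

-- The form B in coordinates

pattern ⟨_,_,_,_,_,_,_,_⟩ a₁ a₂ a₃ a₄ a₅ a₆ a₇ a₈ = a₁ ∷ a₂ ∷ a₃ ∷ a₄ ∷ a₅ ∷ a₆ ∷ a₇ ∷ a₈ ∷ []

weights : Vec ℤ 8
weights = ⟨ + 30 , + 30 , + 10 , + 2 , + 3 , + 5 , + 10 , + 30 ⟩

-- Everything here is written over an arbitrary raw ring so that it can be read
-- both as integer functions and as ring-solver expressions; over ℤ, form is B.
module Coordinates (R : RawRing 0ℓ 0ℓ) (κ : ℤ → RawRing.Carrier R) where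
  open RawRing R public using (_+_; _*_)
  open RawRing R using (Carrier; -_; 0#)

  infixl 6 _-_
  _-_ : Carrier → Carrier → Carrier
  x - y = x + - y

  sum : ∀ {n} → Vec Carrier n → Carrier
  sum = foldr _ _+_ 0#

  form : Vec Carrier 8 → Vec Carrier 8 → Carrier
  form u v = sum (map (λ i → lookup u i * sum (map (λ j → κ (adj i j) * lookup v j) (allFin 8))) (allFin 8))

  ⟪_,_⟫ : Vec Carrier 8 → Vec Carrier 8 → Carrier
  ⟪ ⟨ u₁ , u₂ , u₃ , u₄ , u₅ , u₆ , u₇ , u₈ ⟩ , ⟨ v₁ , v₂ , v₃ , v₄ , v₅ , v₆ , v₇ , v₈ ⟩ ⟫ =
    κ (+ 2) * (u₁ * v₁ + u₂ * v₂ + u₃ * v₃ + u₄ * v₄ + u₅ * v₅ + u₆ * v₆ + u₇ * v₇ + u₈ * v₈)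
    - (u₁ * v₃ + u₃ * v₁) - (u₃ * v₄ + u₄ * v₃) - (u₄ * v₅ + u₅ * v₄) - (u₅ * v₆ + u₆ * v₅)
    - (u₆ * v₇ + u₇ * v₆) - (u₇ * v₈ + u₈ * v₇) - (u₂ * v₄ + u₄ * v₂)

  -- Completing squares in v₁, v₂, …, v₈ in turn.
  linearForms : Vec Carrier 8 → Vec Carrier 8
  linearForms ⟨ v₁ , v₂ , v₃ , v₄ , v₅ , v₆ , v₇ , v₈ ⟩ =
    ⟨ κ (+ 2) * v₁ - v₃ , κ (+ 2) * v₂ - v₄ , κ (+ 3) * v₃ - κ (+ 2) * v₄ , κ (+ 5) * v₄ - κ (+ 6) * v₅
    , κ (+ 4) * v₅ - κ (+ 5) * v₆ , κ (+ 3) * v₆ - κ (+ 4) * v₇ , κ (+ 2) * v₇ - κ (+ 3) * v₈ , v₈ ⟩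

  axpy : Vec Carrier 8 → Carrier → Vec Carrier 8 → Vec Carrier 8
  axpy u c v = zipWith _-_ u (map (c *_) v)

  sumOfSquares : Vec Carrier 8 → Carrier
  sumOfSquares v = sum (zipWith (λ w ℓ → κ w * (ℓ * ℓ)) weights (linearForms v))

open Coordinates +-*-rawRing id using (⟪_,_⟫; linearForms; sumOfSquares)

polynomialRing : ℕ → RawRing 0ℓ 0ℓ
polynomialRing n = record
  { Carrier = Polynomial n ; _≈_ = _≡_ ; _+_ = _:+_ ; _*_ = _:*_ ; -_ = :-_ ; 0# = con 0ℤ ; 1# = con 1ℤ }

module P {n : ℕ} = Coordinates (polynomialRing n) con

open import Data.Integer using (_+_; _*_; _-_; -_; _≤_; _<_; +≤+; +<+; _≤?_; _<?_)

B≡⟪⟫ : ∀ u v → B u v ≡ ⟪ u , v ⟫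
B≡⟪⟫ ⟨ u₁ , u₂ , u₃ , u₄ , u₅ , u₆ , u₇ , u₈ ⟩ ⟨ v₁ , v₂ , v₃ , v₄ , v₅ , v₆ , v₇ , v₈ ⟩ =
  solve 16 (λ u₁ u₂ u₃ u₄ u₅ u₆ u₇ u₈ v₁ v₂ v₃ v₄ v₅ v₆ v₇ v₈ →
    let u = ⟨ u₁ , u₂ , u₃ , u₄ , u₅ , u₆ , u₇ , u₈ ⟩; v = ⟨ v₁ , v₂ , v₃ , v₄ , v₅ , v₆ , v₇ , v₈ ⟩
    in P.form u v := P.⟪ u , v ⟫)
    refl u₁ u₂ u₃ u₄ u₅ u₆ u₇ u₈ v₁ v₂ v₃ v₄ v₅ v₆ v₇ v₈

B-sym : ∀ u v → B u v ≡ B v u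
B-sym ⟨ u₁ , u₂ , u₃ , u₄ , u₅ , u₆ , u₇ , u₈ ⟩ ⟨ v₁ , v₂ , v₃ , v₄ , v₅ , v₆ , v₇ , v₈ ⟩ =
  solve 16 (λ u₁ u₂ u₃ u₄ u₅ u₆ u₇ u₈ v₁ v₂ v₃ v₄ v₅ v₆ v₇ v₈ →
    let u = ⟨ u₁ , u₂ , u₃ , u₄ , u₅ , u₆ , u₇ , u₈ ⟩; v = ⟨ v₁ , v₂ , v₃ , v₄ , v₅ , v₆ , v₇ , v₈ ⟩
    in P.form u v := P.form v u)
    refl u₁ u₂ u₃ u₄ u₅ u₆ u₇ u₈ v₁ v₂ v₃ v₄ v₅ v₆ v₇ v₈

B-linearʳ : ∀ w u c v → B w (u −ᵥ (c ·ᵥ v)) ≡ B w u - c * B w v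
B-linearʳ ⟨ w₁ , w₂ , w₃ , w₄ , w₅ , w₆ , w₇ , w₈ ⟩ ⟨ u₁ , u₂ , u₃ , u₄ , u₅ , u₆ , u₇ , u₈ ⟩ c ⟨ v₁ , v₂ , v₃ , v₄ , v₅ , v₆ , v₇ , v₈ ⟩ =
  solve 25 (λ w₁ w₂ w₃ w₄ w₅ w₆ w₇ w₈ u₁ u₂ u₃ u₄ u₅ u₆ u₇ u₈ c v₁ v₂ v₃ v₄ v₅ v₆ v₇ v₈ →
    let w = ⟨ w₁ , w₂ , w₃ , w₄ , w₅ , w₆ , w₇ , w₈ ⟩; u = ⟨ u₁ , u₂ , u₃ , u₄ , u₅ , u₆ , u₇ , u₈ ⟩; v = ⟨ v₁ , v₂ , v₃ , v₄ , v₅ , v₆ , v₇ , v₈ ⟩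
    in P.form w (P.axpy u c v) := P.form w u P.- c :* P.form w v)
    refl w₁ w₂ w₃ w₄ w₅ w₆ w₇ w₈ u₁ u₂ u₃ u₄ u₅ u₆ u₇ u₈ c v₁ v₂ v₃ v₄ v₅ v₆ v₇ v₈

B-norm-axpy : ∀ u c v → B (u −ᵥ (c ·ᵥ v)) (u −ᵥ (c ·ᵥ v)) ≡ B u u - + 2 * c * B v u + c * c * B v v
B-norm-axpy ⟨ u₁ , u₂ , u₃ , u₄ , u₅ , u₆ , u₇ , u₈ ⟩ c ⟨ v₁ , v₂ , v₃ , v₄ , v₅ , v₆ , v₇ , v₈ ⟩ =
  solve 17 (λ u₁ u₂ u₃ u₄ u₅ u₆ u₇ u₈ c v₁ v₂ v₃ v₄ v₅ v₆ v₇ v₈ →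
    let u = ⟨ u₁ , u₂ , u₃ , u₄ , u₅ , u₆ , u₇ , u₈ ⟩; v = ⟨ v₁ , v₂ , v₃ , v₄ , v₅ , v₆ , v₇ , v₈ ⟩
    in P.form (P.axpy u c v) (P.axpy u c v) := P.form u u P.- con (+ 2) :* c :* P.form v u P.+ c :* c :* P.form v v)
    refl u₁ u₂ u₃ u₄ u₅ u₆ u₇ u₈ c v₁ v₂ v₃ v₄ v₅ v₆ v₇ v₈

B-negʳ : ∀ u v → B u (negV v) ≡ - B u v
B-negʳ ⟨ u₁ , u₂ , u₃ , u₄ , u₅ , u₆ , u₇ , u₈ ⟩ ⟨ v₁ , v₂ , v₃ , v₄ , v₅ , v₆ , v₇ , v₈ ⟩ =
  solve 16 (λ u₁ u₂ u₃ u₄ u₅ u₆ u₇ u₈ v₁ v₂ v₃ v₄ v₅ v₆ v₇ v₈ →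
    let u = ⟨ u₁ , u₂ , u₃ , u₄ , u₅ , u₆ , u₇ , u₈ ⟩; v = ⟨ v₁ , v₂ , v₃ , v₄ , v₅ , v₆ , v₇ , v₈ ⟩
    in P.form u (map :-_ v) := :- P.form u v)
    refl u₁ u₂ u₃ u₄ u₅ u₆ u₇ u₈ v₁ v₂ v₃ v₄ v₅ v₆ v₇ v₈

sixty*B≡sumOfSquares : ∀ v → + 60 * B v v ≡ sumOfSquares v
sixty*B≡sumOfSquares ⟨ v₁ , v₂ , v₃ , v₄ , v₅ , v₆ , v₇ , v₈ ⟩ =
  solve 8 (λ v₁ v₂ v₃ v₄ v₅ v₆ v₇ v₈ →
    let v = ⟨ v₁ , v₂ , v₃ , v₄ , v₅ , v₆ , v₇ , v₈ ⟩
    in con (+ 60) :* P.form v v := P.sumOfSquares v)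
    refl v₁ v₂ v₃ v₄ v₅ v₆ v₇ v₈

B-diag : ∀ v → B v v ≡ sumV (tabulate λ i → lookup v i * B (simple i) v)
B-diag ⟨ v₁ , v₂ , v₃ , v₄ , v₅ , v₆ , v₇ , v₈ ⟩ =
  solve 8 (λ v₁ v₂ v₃ v₄ v₅ v₆ v₇ v₈ →
    let v = ⟨ v₁ , v₂ , v₃ , v₄ , v₅ , v₆ , v₇ , v₈ ⟩
    in P.form v v := P.sum (tabulate λ i → lookup v i :* P.form (map con (simple i)) v))
    refl v₁ v₂ v₃ v₄ v₅ v₆ v₇ v₈

B-2θ : ∀ v → B ((+ 2) ·ᵥ θ) v ≡ + 2 * lookup v (fromℕ 7)
B-2θ ⟨ v₁ , v₂ , v₃ , v₄ , v₅ , v₆ , v₇ , v₈ ⟩ =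
  solve 8 (λ v₁ v₂ v₃ v₄ v₅ v₆ v₇ v₈ →
    let v = ⟨ v₁ , v₂ , v₃ , v₄ , v₅ , v₆ , v₇ , v₈ ⟩
    in P.form (map con ((+ 2) ·ᵥ θ)) v := con (+ 2) :* v₈)
    refl v₁ v₂ v₃ v₄ v₅ v₆ v₇ v₈

sum-linear : ∀ u c v → sumV (u −ᵥ (c ·ᵥ v)) ≡ sumV u - c * sumV v
sum-linear ⟨ u₁ , u₂ , u₃ , u₄ , u₅ , u₆ , u₇ , u₈ ⟩ c ⟨ v₁ , v₂ , v₃ , v₄ , v₅ , v₆ , v₇ , v₈ ⟩ =
  solve 17 (λ u₁ u₂ u₃ u₄ u₅ u₆ u₇ u₈ c v₁ v₂ v₃ v₄ v₅ v₆ v₇ v₈ →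
    let u = ⟨ u₁ , u₂ , u₃ , u₄ , u₅ , u₆ , u₇ , u₈ ⟩; v = ⟨ v₁ , v₂ , v₃ , v₄ , v₅ , v₆ , v₇ , v₈ ⟩
    in P.sum (P.axpy u c v) := P.sum u P.- c :* P.sum v)
    refl u₁ u₂ u₃ u₄ u₅ u₆ u₇ u₈ c v₁ v₂ v₃ v₄ v₅ v₆ v₇ v₈

-- Reflections

lookup-axpy : ∀ u c v i → lookup (u −ᵥ (c ·ᵥ v)) i ≡ lookup u i - c * lookup v i
lookup-axpy u c v i =
  trans (VecP.lookup-zipWith _-_ i u (c ·ᵥ v)) (cong (_-_ (lookup u i)) (VecP.lookup-map i (c *_) v))

lookup-ext : ∀ {u v : Vect} → (∀ i → lookup u i ≡ lookup v i) → u ≡ v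
lookup-ext {u} {v} h =
  trans (sym (VecP.tabulate∘lookup u)) (trans (VecP.tabulate-cong h) (VecP.tabulate∘lookup v))

lookup-refl' : ∀ β γ i → lookup (refl' β γ) i ≡ lookup γ i - B β γ * lookup β i
lookup-refl' β γ = lookup-axpy γ (B β γ) β

refl'-linear : ∀ β γ c δ → refl' β (γ −ᵥ (c ·ᵥ δ)) ≡ refl' β γ −ᵥ (c ·ᵥ refl' β δ)
refl'-linear β γ c δ = lookup-ext λ i → begin
  lookup (refl' β (γ −ᵥ (c ·ᵥ δ))) i
    ≡⟨ lookup-refl' β (γ −ᵥ (c ·ᵥ δ)) i ⟩
  lookup (γ −ᵥ (c ·ᵥ δ)) i - B β (γ −ᵥ (c ·ᵥ δ)) * lookup β i
    ≡⟨ cong₂ (λ x b → x - b * lookup β i) (lookup-axpy γ c δ i) (B-linearʳ β γ c δ) ⟩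
  lookup γ i - c * lookup δ i - (B β γ - c * B β δ) * lookup β i
    ≡⟨ regroup (lookup γ i) c (lookup δ i) (B β γ) (B β δ) (lookup β i) ⟩
  (lookup γ i - B β γ * lookup β i) - c * (lookup δ i - B β δ * lookup β i)
    ≡⟨ cong₂ (λ x y → x - c * y) (lookup-refl' β γ i) (lookup-refl' β δ i) ⟨
  lookup (refl' β γ) i - c * lookup (refl' β δ) i
    ≡⟨ lookup-axpy (refl' β γ) c (refl' β δ) i ⟨
  lookup (refl' β γ −ᵥ (c ·ᵥ refl' β δ)) i
    ∎
  where
  open ≡-Reasoning
  regroup : ∀ g c d p q b → g - c * d - (p - c * q) * b ≡ (g - p * b) - c * (d - q * b)
  regroup = solve-∀

refl'-fixes : ∀ β γ → Orth β γ → refl' β γ ≡ γ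
refl'-fixes β γ β⊥γ = lookup-ext λ i → begin
  lookup (refl' β γ) i             ≡⟨ lookup-refl' β γ i ⟩
  lookup γ i - B β γ * lookup β i  ≡⟨ cong (λ b → lookup γ i - b * lookup β i) β⊥γ ⟩
  lookup γ i - 0ℤ * lookup β i     ≡⟨ x-0≡x (lookup γ i) (lookup β i) ⟩
  lookup γ i                       ∎
  where
  open ≡-Reasoning
  x-0≡x : ∀ x b → x - 0ℤ * b ≡ x
  x-0≡x = solve-∀

refl'-commute : ∀ β β′ → Orth β β′ → ∀ x → refl' β (refl' β′ x) ≡ refl' β′ (refl' β x)
refl'-commute β β′ β⊥β′ x = lookup-ext λ i → begin
  lookup (refl' β (refl' β′ x)) i
    ≡⟨ lookup-refl' β (refl' β′ x) i ⟩
  lookup (refl' β′ x) i - B β (refl' β′ x) * lookup β i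
    ≡⟨ cong₂ (λ y c → y - c * lookup β i) (lookup-refl' β′ x i) (B-linearʳ β x (B β′ x) β′) ⟩
  lookup x i - b′ * lookup β′ i - (b - b′ * B β β′) * lookup β i
    ≡⟨ cong (λ o → lookup x i - b′ * lookup β′ i - (b - b′ * o) * lookup β i) β⊥β′ ⟩
  lookup x i - b′ * lookup β′ i - (b - b′ * 0ℤ) * lookup β i
    ≡⟨ swap (lookup x i) b b′ (lookup β i) (lookup β′ i) ⟩
  lookup x i - b * lookup β i - (b′ - b * 0ℤ) * lookup β′ i
    ≡⟨ cong (λ o → lookup x i - b * lookup β i - (b′ - b * o) * lookup β′ i) (trans (B-sym β′ β) β⊥β′) ⟨
  lookup x i - b * lookup β i - (b′ - b * B β′ β) * lookup β′ i
    ≡⟨ cong₂ (λ y c → y - c * lookup β′ i) (lookup-refl' β x i) (B-linearʳ β′ x b β) ⟨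
  lookup (refl' β x) i - B β′ (refl' β x) * lookup β′ i
    ≡⟨ lookup-refl' β′ (refl' β x) i ⟨
  lookup (refl' β′ (refl' β x)) i
    ∎
  where
  open ≡-Reasoning
  b = B β x
  b′ = B β′ x
  swap : ∀ x b b′ p p′ → x - b′ * p′ - (b - b′ * 0ℤ) * p ≡ x - b * p - (b′ - b * 0ℤ) * p′
  swap = solve-∀

refl'-neg : ∀ β γ → refl' β (negV γ) ≡ negV (refl' β γ)
refl'-neg β γ = lookup-ext λ i → begin
  lookup (refl' β (negV γ)) i                   ≡⟨ lookup-refl' β (negV γ) i ⟩
  lookup (negV γ) i - B β (negV γ) * lookup β i ≡⟨ cong₂ (λ y c → y - c * lookup β i) (VecP.lookup-map i -_ γ) (B-negʳ β γ) ⟩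
  - lookup γ i - - B β γ * lookup β i           ≡⟨ neg-distrib (lookup γ i) (B β γ) (lookup β i) ⟩
  - (lookup γ i - B β γ * lookup β i)           ≡⟨ cong -_ (lookup-refl' β γ i) ⟨
  - lookup (refl' β γ) i                        ≡⟨ VecP.lookup-map i -_ (refl' β γ) ⟨
  lookup (negV (refl' β γ)) i                   ∎
  where
  open ≡-Reasoning
  neg-distrib : ∀ g c b → - g - - c * b ≡ - (g - c * b)
  neg-distrib = solve-∀

module _ (β : Vect) (root : IsRoot β) where

  B-refl'ʳ : ∀ γ → B β (refl' β γ) ≡ - B β γ
  B-refl'ʳ γ = begin
    B β (refl' β γ)           ≡⟨ B-linearʳ β γ (B β γ) β ⟩
    B β γ - B β γ * B β β     ≡⟨ cong (λ b → B β γ - B β γ * b) root ⟩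
    B β γ - B β γ * + 2       ≡⟨ b-2b≡-b (B β γ) ⟩
    - B β γ                   ∎
    where
    open ≡-Reasoning
    b-2b≡-b : ∀ b → b - b * + 2 ≡ - b
    b-2b≡-b = solve-∀

  refl'-involutive : ∀ γ → refl' β (refl' β γ) ≡ γ
  refl'-involutive γ = lookup-ext λ i → begin
    lookup (refl' β (refl' β γ)) i                         ≡⟨ lookup-refl' β (refl' β γ) i ⟩
    lookup (refl' β γ) i - B β (refl' β γ) * lookup β i     ≡⟨ cong₂ (λ x c → x - c * lookup β i)
                                                                 (lookup-refl' β γ i) (B-refl'ʳ γ) ⟩
    lookup γ i - B β γ * lookup β i - - B β γ * lookup β i  ≡⟨ cancel (lookup γ i) (B β γ) (lookup β i) ⟩
    lookup γ i                                              ∎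
    where
    open ≡-Reasoning
    cancel : ∀ x c b → x - c * b - - c * b ≡ x
    cancel = solve-∀

  refl'-isometry : ∀ x y → B (refl' β x) (refl' β y) ≡ B x y
  refl'-isometry x y = begin
    B (refl' β x) (refl' β y)               ≡⟨ B-linearʳ (refl' β x) y b β ⟩
    B (refl' β x) y - b * B (refl' β x) β   ≡⟨ cong₂ (λ p q → p - b * q) (B-sym (refl' β x) y) (B-sym (refl' β x) β) ⟩
    B y (refl' β x) - b * B β (refl' β x)   ≡⟨ cong₂ (λ p q → p - b * q) (B-linearʳ y x a β) (B-refl'ʳ x) ⟩
    B y x - a * B y β - b * - a             ≡⟨ cong₂ (λ p q → p - a * q - b * - a) (B-sym y x) (B-sym y β) ⟩
    B x y - a * b - b * - a                 ≡⟨ cancel (B x y) a b ⟩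
    B x y                                   ∎
    where
    open ≡-Reasoning
    a = B β x
    b = B β y
    cancel : ∀ z a b → z - a * b - b * - a ≡ z
    cancel = solve-∀

  refl'-conjugate : ∀ γ δ → refl' (refl' β γ) (refl' β δ) ≡ refl' β (refl' γ δ)
  refl'-conjugate γ δ = begin
    refl' β δ −ᵥ (B (refl' β γ) (refl' β δ) ·ᵥ refl' β γ) ≡⟨ cong (λ c → refl' β δ −ᵥ (c ·ᵥ refl' β γ)) (refl'-isometry γ δ) ⟩
    refl' β δ −ᵥ (B γ δ ·ᵥ refl' β γ)                     ≡⟨ refl'-linear β δ (B γ δ) γ ⟨
    refl' β (refl' γ δ)                                   ∎
    where open ≡-Reasoning

-- Positive definiteness

*-nonneg : ∀ {a b} → 0ℤ ≤ a → 0ℤ ≤ b → 0ℤ ≤ a * b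
*-nonneg {+ m} {+ n} _ _ = subst (0ℤ ≤_) (ℤP.pos-* m n) (+≤+ ℕ.z≤n)

square-nonneg : ∀ x → 0ℤ ≤ x * x
square-nonneg (+ m)    = *-nonneg {+ m} {+ m} (+≤+ ℕ.z≤n) (+≤+ ℕ.z≤n)
square-nonneg -[1+ m ] = +≤+ ℕ.z≤n

sum-nonneg : ∀ {n} {xs : Vec ℤ n} → VAll.All (0ℤ ≤_) xs → 0ℤ ≤ sumV xs
sum-nonneg []       = ℤP.≤-refl
sum-nonneg (p ∷ ps) = ℤP.+-mono-≤ p (sum-nonneg ps)

sum-nonneg-≤0 : ∀ {n} {xs : Vec ℤ n} → VAll.All (0ℤ ≤_) xs → sumV xs ≤ 0ℤ → VAll.All (_≡ 0ℤ) xs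
sum-nonneg-≤0 []                  _  = []
sum-nonneg-≤0 {xs = x ∷ xs} (p ∷ ps) le = ℤP.≤-antisym x≤0 p ∷ sum-nonneg-≤0 ps rest≤0
  where
  x≤0 : x ≤ 0ℤ
  x≤0 = ℤP.≤-trans (ℤP.≤-reflexive (sym (ℤP.+-identityʳ x))) (ℤP.≤-trans (ℤP.+-monoʳ-≤ x (sum-nonneg ps)) le)
  rest≤0 : sumV xs ≤ 0ℤ
  rest≤0 = ℤP.≤-trans (ℤP.≤-reflexive (sym (ℤP.+-identityˡ (sumV xs)))) (ℤP.≤-trans (ℤP.+-monoˡ-≤ (sumV xs) p) le)

sum-nonpos : ∀ {n} (f : Fin n → ℤ) → (∀ i → f i ≤ 0ℤ) → sumV (tabulate f) ≤ 0ℤ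
sum-nonpos {ℕ.zero}  f f≤0 = ℤP.≤-refl
sum-nonpos {ℕ.suc n} f f≤0 = ℤP.+-mono-≤ (f≤0 zero) (sum-nonpos (f ∘ suc) (f≤0 ∘ suc))

product-nonpos : ∀ {x c} → 0ℤ ≤ x → ¬ (0ℤ < x × 0ℤ < c) → x * c ≤ 0ℤ
product-nonpos {+ ℕ.zero}  _ _ = ℤP.≤-refl
product-nonpos {+ ℕ.suc n} {c} _ not-both = subst (+ ℕ.suc n * c ≤_) (ℤP.*-zeroʳ (+ ℕ.suc n))
  (ℤP.*-monoˡ-≤-nonNeg (+ ℕ.suc n) (ℤP.≮⇒≥ λ c>0 → not-both (+<+ (ℕ.s≤s ℕ.z≤n) , c>0)))

weighted-squares : ∀ {n} → Vec ℤ n → Vec ℤ n → Vec ℤ n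
weighted-squares = zipWith λ w ℓ → w * (ℓ * ℓ)

weighted-squares-nonneg : ∀ {n} {ws : Vec ℤ n} → VAll.All (0ℤ <_) ws → ∀ ℓs → VAll.All (0ℤ ≤_) (weighted-squares ws ℓs)
weighted-squares-nonneg []       []       = []
weighted-squares-nonneg (p ∷ ps) (ℓ ∷ ℓs) = *-nonneg (ℤP.<⇒≤ p) (square-nonneg ℓ) ∷ weighted-squares-nonneg ps ℓs

weighted-squares-zero : ∀ {n} {ws : Vec ℤ n} → VAll.All (0ℤ <_) ws → ∀ ℓs →
                        VAll.All (_≡ 0ℤ) (weighted-squares ws ℓs) → VAll.All (_≡ 0ℤ) ℓs
weighted-squares-zero []       []       []       = []
weighted-squares-zero {ws = w ∷ _} (p ∷ ps) (ℓ ∷ ℓs) (e ∷ es) = ℓ≡0 ∷ weighted-squares-zero ps ℓs es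
  where
  ℓ≡0 : ℓ ≡ 0ℤ
  ℓ≡0 with ℤP.i*j≡0⇒i≡0∨j≡0 w e
  ... | inj₁ refl = contradiction p (ℤP.<-irrefl refl)
  ... | inj₂ ℓℓ≡0 with ℤP.i*j≡0⇒i≡0∨j≡0 ℓ ℓℓ≡0
  ...   | inj₁ ℓ≡0 = ℓ≡0
  ...   | inj₂ ℓ≡0 = ℓ≡0

weights-positive : VAll.All (0ℤ <_) weights
weights-positive = toWitness {a? = VAll.all? (0ℤ <?_) weights} tt

B-nonneg : ∀ v → 0ℤ ≤ B v v
B-nonneg v = ℤP.*-cancelˡ-≤-pos 0ℤ (B v v) (+ 60)
  (subst (0ℤ ≤_) (sym (sixty*B≡sumOfSquares v)) (sum-nonneg (weighted-squares-nonneg weights-positive (linearForms v))))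

0ᵥ : Vect
0ᵥ = replicate 8 0ℤ

leading-zero : ∀ k {x y} → + ℕ.suc k * x - y ≡ 0ℤ → y ≡ 0ℤ → x ≡ 0ℤ
leading-zero k {x} e refl with ℤP.i*j≡0⇒i≡0∨j≡0 (+ ℕ.suc k) (trans (sym (ℤP.+-identityʳ _)) e)
... | inj₂ x≡0 = x≡0

linearForms-zero : ∀ v → VAll.All (_≡ 0ℤ) (linearForms v) → v ≡ 0ᵥ
linearForms-zero ⟨ v₁ , v₂ , v₃ , v₄ , v₅ , v₆ , v₇ , v₈ ⟩ (e₁ ∷ e₂ ∷ e₃ ∷ e₄ ∷ e₅ ∷ e₆ ∷ e₇ ∷ e₈ ∷ []) =
  cong₂ _∷_ z₁ (cong₂ _∷_ z₂ (cong₂ _∷_ z₃ (cong₂ _∷_ z₄ (cong₂ _∷_ z₅ (cong₂ _∷_ z₆ (cong₂ _∷_ z₇ (cong₂ _∷_ e₈ refl)))))))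
  where
  z₇ = leading-zero 1 e₇ (cong (+ 3 *_) e₈)
  z₆ = leading-zero 2 e₆ (cong (+ 4 *_) z₇)
  z₅ = leading-zero 3 e₅ (cong (+ 5 *_) z₆)
  z₄ = leading-zero 4 e₄ (cong (+ 6 *_) z₅)
  z₃ = leading-zero 2 e₃ (cong (+ 2 *_) z₄)
  z₂ = leading-zero 1 e₂ z₄
  z₁ = leading-zero 1 e₁ z₃

B-definite : ∀ v → B v v ≤ 0ℤ → v ≡ 0ᵥ
B-definite v B≤0 = linearForms-zero v (weighted-squares-zero weights-positive (linearForms v)
  (sum-nonneg-≤0 (weighted-squares-nonneg weights-positive (linearForms v)) sumOfSquares≤0))
  where
  sumOfSquares≤0 : sumOfSquares v ≤ 0ℤ
  sumOfSquares≤0 = subst (_≤ 0ℤ) (sixty*B≡sumOfSquares v) (ℤP.*-monoˡ-≤-nonNeg (+ 60) B≤0)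

α₈ : Vect
α₈ = simple (fromℕ 7)

height₈ height₇ : Vect → ℤ
height₈ v = lookup v (fromℕ 7)
height₇ v = lookup v (inject₁ (fromℕ 6))

_≟ᵥ_ : DecidableEquality Vect
_≟ᵥ_ = VecP.≡-dec ℤ._≟_

open import Data.List.Membership.DecPropositional _≟ᵥ_ using (_∈?_)
open import Data.List.Relation.Unary.Unique.DecPropositional _≟ᵥ_ using (unique?)

-- The deciders below evaluate B through ⟪_,_⟫ and reflections through reflectᶠ;
-- normalising B itself inside a decision procedure is far too slow.
reflectᶠ : Vect → Vect → Vect
reflectᶠ β γ = γ −ᵥ (⟪ β , γ ⟫ ·ᵥ β)

refl'≡reflectᶠ : ∀ β γ → refl' β γ ≡ reflectᶠ β γ
refl'≡reflectᶠ β γ = cong (λ c → γ −ᵥ (c ·ᵥ β)) (B≡⟪⟫ β γ)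

decide-at : ∀ {A : Set} (P : A → Set) {x y : A} → x ≡ y → Dec (P y) → Dec (P x)
decide-at P x≡y = map′ (subst P (sym x≡y)) (subst P x≡y)

IsRoot? : ∀ v → Dec (IsRoot v)
IsRoot? v = decide-at (_≡ + 2) (B≡⟪⟫ v v) (⟪ v , v ⟫ ℤ.≟ + 2)

Orth? : ∀ u v → Dec (Orth u v)
Orth? u v = decide-at (_≡ 0ℤ) (B≡⟪⟫ u v) (⟪ u , v ⟫ ℤ.≟ 0ℤ)

IsPos? : ∀ v → Dec (IsPos v)
IsPos? v = IsRoot? v ×-dec VAll.all? (0ℤ ≤?_) v

U? : ∀ v → Dec (U v)
U? v = IsPos? v ×-dec (height₈ v ℤ.≟ 1ℤ)

U'? : ∀ v → Dec (U' v)
U'? v = IsPos? v ×-dec (height₈ v ℤ.≟ 0ℤ) ×-dec (height₇ v ℤ.≟ 1ℤ)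

ηperpU? : ∀ v → Dec (ηperpU v)
ηperpU? v = U? v ×-dec Orth? v η

simple-root : ∀ i → IsRoot (simple i)
simple-root = toWitness {a? = FinP.all? λ i → IsRoot? (simple i)} tt

simple-coordinate : ∀ i j → i ≡ j ⊎ lookup (simple i) j ≡ 0ℤ
simple-coordinate = toWitness {a? = FinP.all? λ i → FinP.all? λ j → (i Fin.≟ j) ⊎-dec (lookup (simple i) j ℤ.≟ 0ℤ)} tt

simple-diagonal : ∀ i → lookup (simple i) i ≡ 1ℤ
simple-diagonal = toWitness {a? = FinP.all? λ i → lookup (simple i) i ℤ.≟ 1ℤ} tt

sum-simple : ∀ i → sumV (simple i) ≡ 1ℤ
sum-simple = toWitness {a? = FinP.all? λ i → sumV (simple i) ℤ.≟ 1ℤ} tt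

s-simple-diagonal : ∀ i → lookup (s i (simple i)) i ≡ - 1ℤ
s-simple-diagonal i = begin
  lookup (s i (simple i)) i                                         ≡⟨ lookup-refl' (simple i) (simple i) i ⟩
  lookup (simple i) i - B (simple i) (simple i) * lookup (simple i) i ≡⟨ cong₂ (λ a b → a - b * a) (simple-diagonal i) (simple-root i) ⟩
  - 1ℤ                                                              ∎
  where open ≡-Reasoning

s-update : ∀ i v → s i v ≡ v [ i ]≔ (lookup v i - B (simple i) v)
s-update i v = lookup-ext λ j → trans (lookup-refl' (simple i) v j) (coordinate j (simple-coordinate i j))
  where
  c = B (simple i) v
  coordinate : ∀ j → i ≡ j ⊎ lookup (simple i) j ≡ 0ℤ →
               lookup v j - c * lookup (simple i) j ≡ lookup (v [ i ]≔ (lookup v i - c)) j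
  coordinate j (inj₁ refl) = begin
    lookup v i - c * lookup (simple i) i ≡⟨ cong (λ a → lookup v i - c * a) (simple-diagonal i) ⟩
    lookup v i - c * 1ℤ                  ≡⟨ cong (_-_ (lookup v i)) (ℤP.*-identityʳ c) ⟩
    lookup v i - c                       ≡⟨ VecP.lookup∘update i v (lookup v i - c) ⟨
    lookup (v [ i ]≔ (lookup v i - c)) i ∎
    where open ≡-Reasoning
  coordinate j (inj₂ αᵢⱼ≡0) = begin
    lookup v j - c * lookup (simple i) j ≡⟨ cong (λ a → lookup v j - c * a) αᵢⱼ≡0 ⟩
    lookup v j - c * 0ℤ                  ≡⟨ x-c*0≡x (lookup v j) c ⟩
    lookup v j                           ≡⟨ VecP.lookup∘update′ j≢i v (lookup v i - c) ⟨
    lookup (v [ i ]≔ (lookup v i - c)) j ∎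
    where
    open ≡-Reasoning
    j≢i : j ≢ i
    j≢i refl = contradiction (trans (sym (simple-diagonal i)) αᵢⱼ≡0) λ ()
    x-c*0≡x : ∀ x c → x - c * 0ℤ ≡ x
    x-c*0≡x = solve-∀

sᶠ : Fin 8 → Vect → Vect
sᶠ i v = v [ i ]≔ (lookup v i - ⟪ simple i , v ⟫)

s≡sᶠ : ∀ i v → s i v ≡ sᶠ i v
s≡sᶠ i v = trans (s-update i v) (cong (λ c → v [ i ]≔ (lookup v i - c)) (B≡⟪⟫ (simple i) v))

s-involutive : ∀ i v → s i (s i v) ≡ v
s-involutive i = refl'-involutive (simple i) (simple-root i)

s-isometry : ∀ i x y → B (s i x) (s i y) ≡ B x y
s-isometry i = refl'-isometry (simple i) (simple-root i)

s-commute : ∀ i j → Orth (simple i) (simple j) → ∀ x → s i (s j x) ≡ s j (s i x)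
s-commute i j = refl'-commute (simple i) (simple j)

s-fixes : ∀ i γ → Orth (simple i) γ → s i γ ≡ γ
s-fixes i = refl'-fixes (simple i)

s-conjugate : ∀ i β γ → refl' (s i β) (s i γ) ≡ s i (refl' β γ)
s-conjugate i = refl'-conjugate (simple i) (simple-root i)

-- The positive roots

coeffs : ℕ → ℕ → ℕ → ℕ → ℕ → ℕ → ℕ → ℕ → Vect
coeffs a₁ a₂ a₃ a₄ a₅ a₆ a₇ a₈ = ⟨ + a₁ , + a₂ , + a₃ , + a₄ , + a₅ , + a₆ , + a₇ , + a₈ ⟩

positiveRoots : List Vect
positiveRoots =
    coeffs 0 0 0 0 0 0 0 1 ∷ coeffs 0 0 0 0 0 0 1 0 ∷ coeffs 0 0 0 0 0 1 0 0 ∷ coeffs 0 0 0 0 1 0 0 0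
  ∷ coeffs 0 0 0 1 0 0 0 0 ∷ coeffs 0 0 1 0 0 0 0 0 ∷ coeffs 0 1 0 0 0 0 0 0 ∷ coeffs 1 0 0 0 0 0 0 0
  ∷ coeffs 0 0 0 0 0 0 1 1 ∷ coeffs 0 0 0 0 0 1 1 0 ∷ coeffs 0 0 0 0 1 1 0 0 ∷ coeffs 0 0 0 1 1 0 0 0
  ∷ coeffs 0 0 1 1 0 0 0 0 ∷ coeffs 0 1 0 1 0 0 0 0 ∷ coeffs 1 0 1 0 0 0 0 0 ∷ coeffs 0 0 0 0 0 1 1 1
  ∷ coeffs 0 0 0 0 1 1 1 0 ∷ coeffs 0 0 0 1 1 1 0 0 ∷ coeffs 0 0 1 1 1 0 0 0 ∷ coeffs 0 1 0 1 1 0 0 0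
  ∷ coeffs 0 1 1 1 0 0 0 0 ∷ coeffs 1 0 1 1 0 0 0 0 ∷ coeffs 0 0 0 0 1 1 1 1 ∷ coeffs 0 0 0 1 1 1 1 0
  ∷ coeffs 0 0 1 1 1 1 0 0 ∷ coeffs 0 1 0 1 1 1 0 0 ∷ coeffs 0 1 1 1 1 0 0 0 ∷ coeffs 1 0 1 1 1 0 0 0
  ∷ coeffs 1 1 1 1 0 0 0 0 ∷ coeffs 0 0 0 1 1 1 1 1 ∷ coeffs 0 0 1 1 1 1 1 0 ∷ coeffs 0 1 0 1 1 1 1 0
  ∷ coeffs 0 1 1 1 1 1 0 0 ∷ coeffs 0 1 1 2 1 0 0 0 ∷ coeffs 1 0 1 1 1 1 0 0 ∷ coeffs 1 1 1 1 1 0 0 0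
  ∷ coeffs 0 0 1 1 1 1 1 1 ∷ coeffs 0 1 0 1 1 1 1 1 ∷ coeffs 0 1 1 1 1 1 1 0 ∷ coeffs 0 1 1 2 1 1 0 0
  ∷ coeffs 1 0 1 1 1 1 1 0 ∷ coeffs 1 1 1 1 1 1 0 0 ∷ coeffs 1 1 1 2 1 0 0 0 ∷ coeffs 0 1 1 1 1 1 1 1
  ∷ coeffs 0 1 1 2 1 1 1 0 ∷ coeffs 0 1 1 2 2 1 0 0 ∷ coeffs 1 0 1 1 1 1 1 1 ∷ coeffs 1 1 1 1 1 1 1 0
  ∷ coeffs 1 1 1 2 1 1 0 0 ∷ coeffs 1 1 2 2 1 0 0 0 ∷ coeffs 0 1 1 2 1 1 1 1 ∷ coeffs 0 1 1 2 2 1 1 0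
  ∷ coeffs 1 1 1 1 1 1 1 1 ∷ coeffs 1 1 1 2 1 1 1 0 ∷ coeffs 1 1 1 2 2 1 0 0 ∷ coeffs 1 1 2 2 1 1 0 0
  ∷ coeffs 0 1 1 2 2 1 1 1 ∷ coeffs 0 1 1 2 2 2 1 0 ∷ coeffs 1 1 1 2 1 1 1 1 ∷ coeffs 1 1 1 2 2 1 1 0
  ∷ coeffs 1 1 2 2 1 1 1 0 ∷ coeffs 1 1 2 2 2 1 0 0 ∷ coeffs 0 1 1 2 2 2 1 1 ∷ coeffs 1 1 1 2 2 1 1 1
  ∷ coeffs 1 1 1 2 2 2 1 0 ∷ coeffs 1 1 2 2 1 1 1 1 ∷ coeffs 1 1 2 2 2 1 1 0 ∷ coeffs 1 1 2 3 2 1 0 0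
  ∷ coeffs 0 1 1 2 2 2 2 1 ∷ coeffs 1 1 1 2 2 2 1 1 ∷ coeffs 1 1 2 2 2 1 1 1 ∷ coeffs 1 1 2 2 2 2 1 0
  ∷ coeffs 1 1 2 3 2 1 1 0 ∷ coeffs 1 2 2 3 2 1 0 0 ∷ coeffs 1 1 1 2 2 2 2 1 ∷ coeffs 1 1 2 2 2 2 1 1
  ∷ coeffs 1 1 2 3 2 1 1 1 ∷ coeffs 1 1 2 3 2 2 1 0 ∷ coeffs 1 2 2 3 2 1 1 0 ∷ coeffs 1 1 2 2 2 2 2 1
  ∷ coeffs 1 1 2 3 2 2 1 1 ∷ coeffs 1 1 2 3 3 2 1 0 ∷ coeffs 1 2 2 3 2 1 1 1 ∷ coeffs 1 2 2 3 2 2 1 0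
  ∷ coeffs 1 1 2 3 2 2 2 1 ∷ coeffs 1 1 2 3 3 2 1 1 ∷ coeffs 1 2 2 3 2 2 1 1 ∷ coeffs 1 2 2 3 3 2 1 0
  ∷ coeffs 1 1 2 3 3 2 2 1 ∷ coeffs 1 2 2 3 2 2 2 1 ∷ coeffs 1 2 2 3 3 2 1 1 ∷ coeffs 1 2 2 4 3 2 1 0
  ∷ coeffs 1 1 2 3 3 3 2 1 ∷ coeffs 1 2 2 3 3 2 2 1 ∷ coeffs 1 2 2 4 3 2 1 1 ∷ coeffs 1 2 3 4 3 2 1 0
  ∷ coeffs 1 2 2 3 3 3 2 1 ∷ coeffs 1 2 2 4 3 2 2 1 ∷ coeffs 1 2 3 4 3 2 1 1 ∷ coeffs 2 2 3 4 3 2 1 0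
  ∷ coeffs 1 2 2 4 3 3 2 1 ∷ coeffs 1 2 3 4 3 2 2 1 ∷ coeffs 2 2 3 4 3 2 1 1 ∷ coeffs 1 2 2 4 4 3 2 1
  ∷ coeffs 1 2 3 4 3 3 2 1 ∷ coeffs 2 2 3 4 3 2 2 1 ∷ coeffs 1 2 3 4 4 3 2 1 ∷ coeffs 2 2 3 4 3 3 2 1
  ∷ coeffs 1 2 3 5 4 3 2 1 ∷ coeffs 2 2 3 4 4 3 2 1 ∷ coeffs 1 3 3 5 4 3 2 1 ∷ coeffs 2 2 3 5 4 3 2 1
  ∷ coeffs 2 2 4 5 4 3 2 1 ∷ coeffs 2 3 3 5 4 3 2 1 ∷ coeffs 2 3 4 5 4 3 2 1 ∷ coeffs 2 3 4 6 4 3 2 1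
  ∷ coeffs 2 3 4 6 5 3 2 1 ∷ coeffs 2 3 4 6 5 4 2 1 ∷ coeffs 2 3 4 6 5 4 3 1 ∷ coeffs 2 3 4 6 5 4 3 2
  ∷ []

simple∈positiveRoots : ∀ i → simple i ∈ positiveRoots
simple∈positiveRoots = toWitness {a? = FinP.all? λ i → simple i ∈? positiveRoots} tt

positiveRoots-closed : ∀ i → All (λ v → B (simple i) v < 0ℤ → s i v ∈ positiveRoots) positiveRoots
positiveRoots-closed = toWitness {a? = FinP.all? λ i → All.all? (λ v →
  decide-at (_< 0ℤ) (B≡⟪⟫ (simple i) v) (⟪ simple i , v ⟫ <? 0ℤ)
  →-dec decide-at (_∈ positiveRoots) (s≡sᶠ i v) (sᶠ i v ∈? positiveRoots)) positiveRoots} tt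

positiveRoots-small-pairing : ∀ i → All (λ v → v ≡ simple i ⊎ B (simple i) v ≤ lookup v i) positiveRoots
positiveRoots-small-pairing = toWitness {a? = FinP.all? λ i → All.all? (λ v →
  (v ≟ᵥ simple i) ⊎-dec decide-at (_≤ lookup v i) (B≡⟪⟫ (simple i) v) (⟪ simple i , v ⟫ ≤? lookup v i)) positiveRoots} tt

-- Since 2 = B(v, v) = Σᵢ vᵢ B(αᵢ, v) and all vᵢ ≥ 0, some term is positive.
positive-pairing : ∀ {v} → IsPos v → ∃ λ i → 0ℤ < lookup v i × 0ℤ < B (simple i) v
positive-pairing {v} (root , nonneg) with FinP.any? (λ i → (0ℤ <? lookup v i) ×-dec (0ℤ <? B (simple i) v))
... | yes found = found
... | no none = contradiction (subst (_≤ 0ℤ) (trans (sym (B-diag v)) root) (sum-nonpos _ terms≤0)) λ { (+≤+ ()) }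
  where
  terms≤0 : ∀ i → lookup v i * B (simple i) v ≤ 0ℤ
  terms≤0 i = product-nonpos (VAllP.lookup⁺ nonneg i) (λ both → none (i , both))

pairing-arithmetic : ∀ q x d → 0ℤ ≤ q → 0ℤ < x → 0ℤ < d → q + + 2 * (x * d) ≡ + 2 → q ≡ 0ℤ × x ≡ 1ℤ
pairing-arithmetic (+ r) (+ ℕ.suc m) (+ ℕ.suc n) _ _ _ eq = cong +_ r≡0 , cong +_ (ℕP.m*n≡1⇒m≡1 _ _ xd≡1)
  where
  xd = ℕ.suc m ℕ.* ℕ.suc n
  eqℕ : r ℕ.+ 2 ℕ.* xd ≡ 2
  eqℕ = ℤP.+-injective eq
  xd≡1 : xd ≡ 1
  xd≡1 = ℕP.≤-antisym (ℕP.*-cancelˡ-≤ 2 (subst (2 ℕ.* xd ℕ.≤_) eqℕ (ℕP.m≤n+m _ r))) (ℕ.s≤s ℕ.z≤n)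
  r≡0 : r ≡ 0
  r≡0 = ℕP.+-cancelʳ-≡ 2 r 0 (subst (λ k → r ℕ.+ 2 ℕ.* k ≡ 2) xd≡1 eqℕ)
pairing-arithmetic -[1+ _ ] _ _ () _ _ _
pairing-arithmetic _ (+ ℕ.zero) _ _ (+<+ ()) _ _
pairing-arithmetic _ -[1+ _ ] _ _ () _ _
pairing-arithmetic _ _ (+ ℕ.zero) _ _ (+<+ ()) _
pairing-arithmetic _ _ -[1+ _ ] _ _ () _

-- For x = vᵢ and c = B(αᵢ, v), B(v - x αᵢ, v - x αᵢ) = 2 - 2x(c - x); definiteness forces x = 1, v = x αᵢ.
large-pairing⇒simple : ∀ i v → IsRoot v → 0ℤ < lookup v i → lookup v i < B (simple i) v → v ≡ simple i
large-pairing⇒simple i v root x>0 x<c = lookup-ext coordinate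
  where
  open ≡-Reasoning
  x = lookup v i
  c = B (simple i) v
  p = v −ᵥ (x ·ᵥ simple i)
  simplify : ∀ x c → + 2 - + 2 * x * c + x * x * + 2 + + 2 * (x * (c - x)) ≡ + 2
  simplify = solve-∀
  norm-p : B p p + + 2 * (x * (c - x)) ≡ + 2
  norm-p = begin
    B p p + + 2 * (x * (c - x))
      ≡⟨ cong (_+ + 2 * (x * (c - x))) (B-norm-axpy v x (simple i)) ⟩
    B v v - + 2 * x * c + x * x * B (simple i) (simple i) + + 2 * (x * (c - x))
      ≡⟨ cong₂ (λ a b → a - + 2 * x * c + x * x * b + + 2 * (x * (c - x))) root (simple-root i) ⟩
    + 2 - + 2 * x * c + x * x * + 2 + + 2 * (x * (c - x))
      ≡⟨ simplify x c ⟩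
    + 2 ∎
  c-x>0 : 0ℤ < c - x
  c-x>0 = subst (_< c - x) (ℤP.+-inverseʳ x) (ℤP.+-monoˡ-< (- x) x<c)
  p≡0×x≡1 = pairing-arithmetic (B p p) x (c - x) (B-nonneg p) x>0 c-x>0 norm-p
  p≡0 : p ≡ 0ᵥ
  p≡0 = B-definite p (ℤP.≤-reflexive (proj₁ p≡0×x≡1))
  coordinate : ∀ j → lookup v j ≡ lookup (simple i) j
  coordinate j = begin
    lookup v j                  ≡⟨ ℤP.i-j≡0⇒i≡j _ _ (trans (sym (lookup-axpy v x (simple i) j))
                                                     (trans (cong (λ u → lookup u j) p≡0) (VecP.lookup-replicate j 0ℤ))) ⟩
    x * lookup (simple i) j     ≡⟨ cong (_* lookup (simple i) j) (proj₂ p≡0×x≡1) ⟩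
    1ℤ * lookup (simple i) j    ≡⟨ ℤP.*-identityˡ _ ⟩
    lookup (simple i) j         ∎

s-root : ∀ i v → IsRoot v → IsRoot (s i v)
s-root i v root = trans (s-isometry i v v) root

s-nonneg-if-small : ∀ {v} i → VAll.All (0ℤ ≤_) v → B (simple i) v ≤ lookup v i → VAll.All (0ℤ ≤_) (s i v)
s-nonneg-if-small {v} i nonneg c≤x = subst (VAll.All (0ℤ ≤_)) (sym (s-update i v)) (VAllP.lookup⁻ coordinate)
  where
  coordinate : ∀ j → 0ℤ ≤ lookup (v [ i ]≔ (lookup v i - B (simple i) v)) j
  coordinate j with i Fin.≟ j
  ... | yes refl = subst (0ℤ ≤_) (sym (VecP.lookup∘update i v _)) (ℤP.i≤j⇒0≤j-i c≤x)
  ... | no i≢j = subst (0ℤ ≤_) (sym (VecP.lookup∘update′ (i≢j ∘ sym) v _)) (VAllP.lookup⁺ nonneg j)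

height : Vect → ℕ
height v = ℤ.∣ sumV v ∣

∣-∣-decreasing : ∀ a c → 0ℤ ≤ a - c → 0ℤ < c → ℤ.∣ a - c ∣ ℕ.< ℤ.∣ a ∣
∣-∣-decreasing a c a-c≥0 c>0 = ℤP.drop‿+<+ (subst₂ _<_ (sym (ℤP.0≤i⇒+∣i∣≡i a-c≥0)) (sym (ℤP.0≤i⇒+∣i∣≡i a≥0)) a-c<a)
  where
  a-c<a : a - c < a
  a-c<a = subst (a - c <_) (ℤP.+-identityʳ a) (ℤP.+-monoʳ-< a (ℤP.neg-mono-< c>0))
  a≥0 : 0ℤ ≤ a
  a≥0 = ℤP.<⇒≤ (ℤP.≤-<-trans a-c≥0 a-c<a)

sum-s : ∀ i v → sumV (s i v) ≡ sumV v - B (simple i) v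
sum-s i v = begin
  sumV (s i v)                                 ≡⟨ sum-linear v (B (simple i) v) (simple i) ⟩
  sumV v - B (simple i) v * sumV (simple i)    ≡⟨ cong (λ h → sumV v - B (simple i) v * h) (sum-simple i) ⟩
  sumV v - B (simple i) v * 1ℤ                 ≡⟨ cong (_-_ (sumV v)) (ℤP.*-identityʳ _) ⟩
  sumV v - B (simple i) v                      ∎
  where open ≡-Reasoning

s-height : ∀ {v} i → VAll.All (0ℤ ≤_) (s i v) → 0ℤ < B (simple i) v → height (s i v) ℕ.< height v
s-height {v} i nonneg c>0 = subst (ℕ._< height v) (cong ℤ.∣_∣ (sym (sum-s i v)))
  (∣-∣-decreasing (sumV v) (B (simple i) v) (subst (0ℤ ≤_) (sum-s i v) (sum-nonneg nonneg)) c>0)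

positive-root∈ : ∀ {v} → IsPos v → v ∈ positiveRoots
positive-root∈ {v} = descend v (ℕInd.<-wellFounded (height v))
  where
  descend : ∀ v → Acc ℕ._<_ (height v) → IsPos v → v ∈ positiveRoots
  descend v (acc smaller) pos@(root , nonneg) with positive-pairing pos
  ... | i , x>0 , c>0 with B (simple i) v ≤? lookup v i
  ...   | no c≰x = subst (_∈ positiveRoots) (sym (large-pairing⇒simple i v root x>0 (ℤP.≰⇒> c≰x))) (simple∈positiveRoots i)
  ...   | yes c≤x = subst (_∈ positiveRoots) (s-involutive i v)
                      (All.lookup (positiveRoots-closed i) sv∈ B<0)
    where
    sv-nonneg = s-nonneg-if-small i nonneg c≤x
    sv∈ : s i v ∈ positiveRoots
    sv∈ = descend (s i v) (smaller (s-height i sv-nonneg c>0)) (s-root i v root , sv-nonneg)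
    B<0 : B (simple i) (s i v) < 0ℤ
    B<0 = subst (_< 0ℤ) (sym (B-refl'ʳ (simple i) (simple-root i) v)) (ℤP.neg-mono-< c>0)

s-positive : ∀ i v → IsPos v → v ≢ simple i → IsPos (s i v)
s-positive i v pos@(root , nonneg) v≢αᵢ = from-pairing (All.lookup (positiveRoots-small-pairing i) (positive-root∈ {v} pos))
  where
  from-pairing : v ≡ simple i ⊎ B (simple i) v ≤ lookup v i → IsPos (s i v)
  from-pairing (inj₁ v≡αᵢ) = contradiction v≡αᵢ v≢αᵢ
  from-pairing (inj₂ c≤x)  = s-root i v root , s-nonneg-if-small i nonneg c≤x

s-preserves-positivity : ∀ {z} i → lookup z i ≡ 0ℤ → IsPos z ⇔ IsPos (s i z)
s-preserves-positivity {z} i zᵢ≡0 = mk⇔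
  (λ pos → s-positive i z pos z≢αᵢ)
  (λ pos → subst IsPos (s-involutive i z) (s-positive i (s i z) pos sz≢αᵢ))
  where
  z≢αᵢ : z ≢ simple i
  z≢αᵢ refl = contradiction (trans (sym zᵢ≡0) (simple-diagonal i)) λ ()
  sz≢αᵢ : s i z ≢ simple i
  sz≢αᵢ sz≡αᵢ = contradiction (trans (sym zᵢ≡0) (trans (cong (λ u → lookup u i) z≡) (s-simple-diagonal i))) λ ()
    where
    z≡ : z ≡ s i (simple i)
    z≡ = trans (sym (s-involutive i z)) (cong (s i) sz≡αᵢ)

IsNeg⇔IsPos-neg : ∀ v → IsNeg v ⇔ IsPos (negV v)
IsNeg⇔IsPos-neg v = mk⇔
  (λ (root , nonpos) → trans B-neg root , VAllP.map⁺ (VAll.map ℤP.neg-mono-≤ nonpos))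
  (λ (root , nonneg) → trans (sym B-neg) root
                     , VAll.map (λ {c} 0≤-c → subst (_≤ 0ℤ) (ℤP.neg-involutive c) (ℤP.neg-mono-≤ 0≤-c)) (VAllP.map⁻ nonneg))
  where
  open ≡-Reasoning
  B-neg : B (negV v) (negV v) ≡ B v v
  B-neg = begin
    B (negV v) (negV v) ≡⟨ B-negʳ (negV v) v ⟩
    - B (negV v) v      ≡⟨ cong -_ (trans (B-sym (negV v) v) (B-negʳ v v)) ⟩
    - - B v v           ≡⟨ ℤP.neg-involutive (B v v) ⟩
    B v v               ∎

s-preserves-negativity : ∀ {z} i → lookup z i ≡ 0ℤ → IsNeg z ⇔ IsNeg (s i z)
s-preserves-negativity {z} i zᵢ≡0 =
  ⇔-trans (IsNeg⇔IsPos-neg z) (⇔-trans (s-preserves-positivity i -zᵢ≡0)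
    (⇔-trans (subst (λ u → IsPos (s i (negV z)) ⇔ IsPos u) (refl'-neg (simple i) z) ⇔-refl) (⇔-sym (IsNeg⇔IsPos-neg (s i z)))))
  where
  -zᵢ≡0 : lookup (negV z) i ≡ 0ℤ
  -zᵢ≡0 = trans (VecP.lookup-map i -_ z) (cong -_ zᵢ≡0)

-- The roots of U and U′

U-roots U'-roots : List Vect
U-roots  = filter U? positiveRoots
U'-roots = filter U'? positiveRoots

U-root∈ : ∀ {v} → U v → v ∈ U-roots
U-root∈ {v} u = ∈P.∈-filter⁺ U? (positive-root∈ {v} (proj₁ u)) u

U'-root∈ : ∀ {v} → U' v → v ∈ U'-roots
U'-root∈ {v} u = ∈P.∈-filter⁺ U'? (positive-root∈ {v} (proj₁ u)) u

U'-roots-unique : Unique U'-roots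
U'-roots-unique = toWitness {a? = unique? U'-roots} tt

η∈U : U η
η∈U = toWitness {a? = U? η} tt

s8-U'⊆η⊥U : All (λ β → ηperpU (s8 β)) U'-roots
s8-U'⊆η⊥U = toWitness {a? = All.all? (λ β → decide-at ηperpU (s≡sᶠ (fromℕ 7) β) (ηperpU? (sᶠ (fromℕ 7) β))) U'-roots} tt

s8-η⊥U⊆U' : All (λ δ → Orth δ η → U' (s8 δ)) U-roots
s8-η⊥U⊆U' = toWitness {a? = All.all? (λ δ → Orth? δ η →-dec decide-at U' (s≡sᶠ (fromℕ 7) δ) (U'? (sᶠ (fromℕ 7) δ))) U-roots} tt

residue-⊥η : All (λ δ → IsPos (refl' η δ) → All (λ β → IsPos (refl' (s8 β) δ) → Orth δ η) U'-roots) U-roots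
residue-⊥η = toWitness {a? = All.all? (λ δ →
  decide-at IsPos (refl'≡reflectᶠ η δ) (IsPos? (reflectᶠ η δ)) →-dec
  All.all? (λ β → decide-at IsPos (trans (refl'≡reflectᶠ (s8 β) δ) (cong (λ x → reflectᶠ x δ) (s≡sᶠ (fromℕ 7) β)))
                                  (IsPos? (reflectᶠ (sᶠ (fromℕ 7) β) δ)) →-dec Orth? δ η) U'-roots) U-roots} tt

orthogonal-triple : List Vect
orthogonal-triple = coeffs 0 0 0 0 0 0 1 0 ∷ coeffs 0 1 1 2 2 2 1 0 ∷ coeffs 2 2 3 4 3 2 1 0 ∷ []

orthogonal-triple-in-U' : PWOrth U' orthogonal-triple
orthogonal-triple-in-U' = toWitness {a? = unique? orthogonal-triple ×-dec All.all? U'? orthogonal-triple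
                                          ×-dec AllPairs.allPairs? Orth? orthogonal-triple} tt

E6⊥α₈ : ∀ i → Orth (simple (embed6 i)) α₈
E6⊥α₈ = toWitness {a? = FinP.all? λ i → Orth? (simple (embed6 i)) α₈} tt

E6⊥η : ∀ i → Orth (simple (embed6 i)) η
E6⊥η = toWitness {a? = FinP.all? λ i → Orth? (simple (embed6 i)) η} tt

E6-heights : ∀ i → height₈ (simple (embed6 i)) ≡ 0ℤ × height₇ (simple (embed6 i)) ≡ 0ℤ
E6-heights = toWitness {a? = FinP.all? λ i → (height₈ (simple (embed6 i)) ℤ.≟ 0ℤ) ×-dec (height₇ (simple (embed6 i)) ℤ.≟ 0ℤ)} tt

-- 2θ - Σ xᵢ: since B(2θ, x) = 2 for x ∈ U, each orthogonal xᵢ lowers its norm by 2.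
besselVector : List Vect → Vect
besselVector []       = (+ 2) ·ᵥ θ
besselVector (x ∷ xs) = besselVector xs −ᵥ (1ℤ ·ᵥ x)

bessel : ∀ {xs} → All U xs → AllPairs Orth xs →
         B (besselVector xs) (besselVector xs) + + 2 * + length xs ≡ + 8
         × (∀ z → height₈ z ≡ 1ℤ → All (Orth z) xs → B z (besselVector xs) ≡ + 2)
bessel [] [] = refl , λ z z₈≡1 _ → trans (B-sym z ((+ 2) ·ᵥ θ)) (trans (B-2θ z) (cong (+ 2 *_) z₈≡1))
bessel {x ∷ xs} (ux ∷ uxs) (x⊥xs ∷ pairs) = norm , pairing
  where
  open ≡-Reasoning
  y = besselVector xs
  ih = bessel uxs pairs
  Bxy : B x y ≡ + 2
  Bxy = proj₂ ih x (proj₂ ux) x⊥xs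
  rearrange : ∀ q k → q - + 2 * 1ℤ * + 2 + 1ℤ * 1ℤ * + 2 + + 2 * (1ℤ + k) ≡ q + + 2 * k
  rearrange = solve-∀
  norm : B (y −ᵥ (1ℤ ·ᵥ x)) (y −ᵥ (1ℤ ·ᵥ x)) + + 2 * + length (x ∷ xs) ≡ + 8
  norm = begin
    B (y −ᵥ (1ℤ ·ᵥ x)) (y −ᵥ (1ℤ ·ᵥ x)) + + 2 * + ℕ.suc (length xs)
      ≡⟨ cong (_+ + 2 * + ℕ.suc (length xs)) (B-norm-axpy y 1ℤ x) ⟩
    B y y - + 2 * 1ℤ * B x y + 1ℤ * 1ℤ * B x x + + 2 * (1ℤ + + length xs)
      ≡⟨ cong₂ (λ a b → B y y - + 2 * 1ℤ * a + 1ℤ * 1ℤ * b + + 2 * (1ℤ + + length xs)) Bxy (proj₁ (proj₁ ux)) ⟩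
    B y y - + 2 * 1ℤ * + 2 + 1ℤ * 1ℤ * + 2 + + 2 * (1ℤ + + length xs)
      ≡⟨ rearrange (B y y) (+ length xs) ⟩
    B y y + + 2 * + length xs
      ≡⟨ proj₁ ih ⟩
    + 8 ∎
  pairing : ∀ z → height₈ z ≡ 1ℤ → All (Orth z) (x ∷ xs) → B z (y −ᵥ (1ℤ ·ᵥ x)) ≡ + 2
  pairing z z₈≡1 (z⊥x ∷ z⊥xs) = begin
    B z (y −ᵥ (1ℤ ·ᵥ x)) ≡⟨ B-linearʳ z y 1ℤ x ⟩
    B z y - 1ℤ * B z x   ≡⟨ cong₂ (λ a b → a - 1ℤ * b) (proj₂ ih z z₈≡1 z⊥xs) z⊥x ⟩
    + 2                  ∎

orthogonal-in-U-length≤4 : ∀ {S} → PWOrth U S → length S ℕ.≤ 4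
orthogonal-in-U-length≤4 {S} (_ , uS , oS) = ℕP.*-cancelˡ-≤ 2 (ℤP.drop‿+≤+ 2len≤8)
  where
  y = besselVector S
  2len≤8 : + (2 ℕ.* length S) ≤ + 8
  2len≤8 = subst₂ _≤_ (sym (ℤP.pos-* 2 (length S))) (proj₁ (bessel uS oS))
    (subst (_≤ B y y + + 2 * + length S) (ℤP.+-identityˡ _) (ℤP.+-monoˡ-≤ (+ 2 * + length S) (B-nonneg y)))

-- The map ι

s8-involutive : ∀ v → s8 (s8 v) ≡ v
s8-involutive = s-involutive (fromℕ 7)

s8-injective : ∀ β γ → s8 β ≡ s8 γ → β ≡ γ
s8-injective β γ e = trans (sym (s8-involutive β)) (trans (cong s8 e) (s8-involutive γ))

s8-preserves-orthogonality : ∀ a b → Orth a b → Orth (s8 a) (s8 b)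
s8-preserves-orthogonality a b = trans (s-isometry (fromℕ 7) a b)

s8-U'→η⊥U : ∀ β → U' β → ηperpU (s8 β)
s8-U'→η⊥U β u = All.lookup s8-U'⊆η⊥U (U'-root∈ u)

s8-η⊥U→U' : ∀ δ → ηperpU δ → ∃ λ β → U' β × s8 β ≡ δ
s8-η⊥U→U' δ (u , δ⊥η) = s8 δ , All.lookup s8-η⊥U⊆U' (U-root∈ u) δ⊥η , s8-involutive δ

AllPairs-mapWith : ∀ {P : Vect → Set} {R S : Vect → Vect → Set} {xs} →
                   All P xs → (∀ {x y} → P x → P y → R x y → S x y) → AllPairs R xs → AllPairs S xs
AllPairs-mapWith []         f []         = []
AllPairs-mapWith (px ∷ pxs) f (rx ∷ rxs) = All.zipWith (λ (py , r) → f px py r) (pxs , rx) ∷ AllPairs-mapWith pxs f rxs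

orthogonal-roots-unique : ∀ {xs} → All IsRoot xs → AllPairs Orth xs → Unique xs
orthogonal-roots-unique roots = AllPairs-mapWith roots λ {x} root _ x⊥y x≡y →
  contradiction (trans (sym root) (subst (λ y → B x y ≡ 0ℤ) (sym x≡y) x⊥y)) λ ()

ι-PWOrth : ∀ {T} → PWOrth U' T → PWOrth U (ι T)
ι-PWOrth {T} (_ , uT , oT) = orthogonal-roots-unique (All.map (proj₁ ∘ proj₁) uι) oι , uι , oι
  where
  uι : All U (ι T)
  uι = AllP.++⁺ (AllP.map⁺ (All.map (λ {β} u → proj₁ (s8-U'→η⊥U β u)) uT)) (η∈U ∷ [])
  oι : AllPairs Orth (ι T)
  oι = AllPairsP.++⁺ (AllPairsP.map⁺ (AllPairs.map (λ {a} {b} → s8-preserves-orthogonality a b) oT)) ([] ∷ [])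
                     (AllP.map⁺ (All.map (λ {β} u → proj₂ (s8-U'→η⊥U β u) ∷ []) uT))

length-ι : ∀ T → length (ι T) ≡ ℕ.suc (length T)
length-ι T = trans (ListP.length-++ (mapL s8 T)) (trans (cong (ℕ._+ 1) (ListP.length-map s8 T)) (ℕP.+-comm (length T) 1))

Ω-U'-length : ∀ {T} → Ω U' T → length T ≡ 3
Ω-U'-length {T} (pw , maximal) =
  ℕP.≤-antisym (ℕP.≤-pred (subst (ℕ._≤ 4) (length-ι T) (orthogonal-in-U-length≤4 (ι-PWOrth pw))))
               (maximal orthogonal-triple orthogonal-triple-in-U')

ι-Ω : ∀ {T} → Ω U' T → Ω U (ι T)
ι-Ω {T} o@(pw , _) = ι-PWOrth pw , λ S pwS →
  subst (length S ℕ.≤_) (sym (trans (length-ι T) (cong ℕ.suc (Ω-U'-length o)))) (orthogonal-in-U-length≤4 pwS)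

ι-reflects-⊆ : ∀ {T T′} → All U' T → (∀ z → z ∈ ι T → z ∈ ι T′) → ∀ x → x ∈ T → x ∈ T′
ι-reflects-⊆ {T} {T′} uT ι⊆ x x∈T with ∈P.∈-++⁻ (mapL s8 T′) (ι⊆ (s8 x) (∈P.∈-++⁺ˡ (∈P.∈-map⁺ s8 x∈T)))
... | inj₁ s8x∈ with ∈P.∈-map⁻ s8 s8x∈
...   | y , y∈T′ , s8x≡s8y = subst (_∈ T′) (sym (s8-injective x y s8x≡s8y)) y∈T′
ι-reflects-⊆ {T} {T′} uT ι⊆ x x∈T | inj₂ (here s8x≡η) =
  contradiction (trans (sym (cong (λ t → B t η) s8x≡η)) (proj₂ (s8-U'→η⊥U x (All.lookup uT x∈T)))) λ ()

ι-injective : ∀ T T′ → Ω U' T → Ω U' T′ → ι T ≈ˢ ι T′ → T ≈ˢ T′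
ι-injective T T′ ((_ , uT , _) , _) ((_ , uT′ , _) , _) ι≈ x =
  mk⇔ (ι-reflects-⊆ uT (λ z → Equivalence.to (ι≈ z)) x) (ι-reflects-⊆ uT′ (λ z → Equivalence.from (ι≈ z)) x)

-- W(E₆)-equivariance

absV-positive : ∀ v → IsPos v → absV v ≡ v
absV-positive v (root , nonneg) with VAll.all? (λ c → c ℤ.≤? 0ℤ) v
... | yes nonpos = contradiction (trans (sym root) (cong (λ u → B u u) v≡0)) λ ()
  where
  v≡0 : v ≡ 0ᵥ
  v≡0 = lookup-ext λ j → trans (ℤP.≤-antisym (VAllP.lookup⁺ nonpos j) (VAllP.lookup⁺ nonneg j)) (sym (VecP.lookup-replicate j 0ℤ))
... | no _ = refl

E6-preserves-U' : ∀ i v → U' v → U' (s (embed6 i) v)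
E6-preserves-U' i v (pos , v₈≡0 , v₇≡1) =
  s-positive (embed6 i) v pos v≢αᵢ , unchanged (proj₁ (E6-heights i)) v₈≡0 , unchanged (proj₂ (E6-heights i)) v₇≡1
  where
  c = B (simple (embed6 i)) v
  unchanged : ∀ {j a} → lookup (simple (embed6 i)) j ≡ 0ℤ → lookup v j ≡ a → lookup (s (embed6 i) v) j ≡ a
  unchanged {j} {a} αⱼ≡0 vⱼ≡a = begin
    lookup (s (embed6 i) v) j                  ≡⟨ lookup-refl' (simple (embed6 i)) v j ⟩
    lookup v j - c * lookup (simple (embed6 i)) j ≡⟨ cong₂ (λ x y → x - c * y) vⱼ≡a αⱼ≡0 ⟩
    a - c * 0ℤ                                 ≡⟨ cong (_-_ a) (ℤP.*-zeroʳ c) ⟩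
    a - 0ℤ                                     ≡⟨ ℤP.+-identityʳ a ⟩
    a                                          ∎
    where open ≡-Reasoning
  v≢αᵢ : v ≢ simple (embed6 i)
  v≢αᵢ refl = contradiction (trans (sym v₇≡1) (proj₂ (E6-heights i))) λ ()

actW-U' : ∀ w v → U' v → U' (actW w v)
actW-U' []      v u = u
actW-U' (i ∷ w) v u = E6-preserves-U' i (actW w v) (actW-U' w v u)

actW-isometry : ∀ w x y → B (actW w x) (actW w y) ≡ B x y
actW-isometry []      x y = refl
actW-isometry (i ∷ w) x y =
  trans (s-isometry (embed6 i) (actW w x) (actW w y)) (actW-isometry w x y)

actW-fixes-η : ∀ w → actW w η ≡ η
actW-fixes-η []      = refl
actW-fixes-η (i ∷ w) = trans (cong (s (embed6 i)) (actW-fixes-η w)) (s-fixes (embed6 i) η (E6⊥η i))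

actW-s8 : ∀ w x → actW w (s8 x) ≡ s8 (actW w x)
actW-s8 []      x = refl
actW-s8 (i ∷ w) x = trans (cong (s (embed6 i)) (actW-s8 w x)) (s-commute (embed6 i) (fromℕ 7) (E6⊥α₈ i) (actW w x))

·-Ω : ∀ w {T} → Ω U' T → Ω U' (w · T)
·-Ω w {T} ((_ , uT , oT) , maximal) = (orthogonal-roots-unique (All.map (proj₁ ∘ proj₁) uW) oW , uW , oW) , maximalW
  where
  f : Vect → Vect
  f α = absV (actW w α)
  f≡ : ∀ {x} → U' x → f x ≡ actW w x
  f≡ {x} u = absV-positive (actW w x) (proj₁ (actW-U' w x u))
  uW : All U' (w · T)
  uW = AllP.map⁺ (All.map (λ {x} u → subst U' (sym (f≡ u)) (actW-U' w x u)) uT)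
  oW : AllPairs Orth (w · T)
  oW = AllPairsP.map⁺ (AllPairs-mapWith uT (λ {x} {y} ux uy x⊥y →
         trans (cong₂ B (f≡ ux) (f≡ uy)) (trans (actW-isometry w x y) x⊥y)) oT)
  maximalW : ∀ S → PWOrth U' S → length S ℕ.≤ length (w · T)
  maximalW S pwS = subst (length S ℕ.≤_) (sym (ListP.length-map f T)) (maximal S pwS)

ι-equivariant : ∀ w {T} → All U' T → ι (w · T) ≡ w · ι T
ι-equivariant w {T} uT = begin
  mapL s8 (mapL f T) ++ η ∷ []      ≡⟨ cong₂ _++_ (s8-commutes uT) (cong (_∷ []) (sym fη≡η)) ⟩
  mapL f (mapL s8 T) ++ f η ∷ []    ≡⟨ ListP.map-++ f (mapL s8 T) (η ∷ []) ⟨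
  mapL f (mapL s8 T ++ η ∷ [])      ∎
  where
  open ≡-Reasoning
  f : Vect → Vect
  f α = absV (actW w α)
  fη≡η : f η ≡ η
  fη≡η = trans (cong absV (actW-fixes-η w)) (absV-positive η (proj₁ η∈U))
  s8-commutes : ∀ {xs} → All U' xs → mapL s8 (mapL f xs) ≡ mapL f (mapL s8 xs)
  s8-commutes []              = refl
  s8-commutes {x ∷ _} (u ∷ us) = cong₂ _∷_ commute (s8-commutes us)
    where
    s8-act-positive : IsPos (s8 (actW w x))
    s8-act-positive = proj₁ (proj₁ (s8-U'→η⊥U (actW w x) (actW-U' w x u)))
    commute : s8 (f x) ≡ f (s8 x)
    commute = begin
      s8 (absV (actW w x))   ≡⟨ cong s8 (absV-positive (actW w x) (proj₁ (actW-U' w x u))) ⟩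
      s8 (actW w x)          ≡⟨ absV-positive (s8 (actW w x)) s8-act-positive ⟨
      absV (s8 (actW w x))   ≡⟨ cong absV (actW-s8 w x) ⟨
      absV (actW w (s8 x))   ∎

-- Residues

height₈-refl' : ∀ β γ → height₈ β ≡ 0ℤ → height₈ γ ≡ 0ℤ → height₈ (refl' β γ) ≡ 0ℤ
height₈-refl' β γ β₈≡0 γ₈≡0 = begin
  height₈ (refl' β γ)            ≡⟨ lookup-refl' β γ (fromℕ 7) ⟩
  height₈ γ - B β γ * height₈ β  ≡⟨ cong₂ (λ a b → a - B β γ * b) γ₈≡0 β₈≡0 ⟩
  0ℤ - B β γ * 0ℤ                ≡⟨ cong (_-_ 0ℤ) (ℤP.*-zeroʳ (B β γ)) ⟩
  0ℤ                             ∎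
  where open ≡-Reasoning

-- s_{s₈β}(s₈γ) = s₈(s_β γ), and s_β γ has 8-height 0, so it is not ±α₈.
reflection-sign-transfer : ∀ β γ → U' β → U' γ →
                           (IsPos (refl' β γ) ⇔ IsPos (refl' (s8 β) (s8 γ)))
                           × (IsNeg (refl' β γ) ⇔ IsNeg (refl' (s8 β) (s8 γ)))
reflection-sign-transfer β γ (_ , β₈≡0 , _) (_ , γ₈≡0 , _) =
  subst (λ z → IsPos (refl' β γ) ⇔ IsPos z) conjugation (s-preserves-positivity {refl' β γ} (fromℕ 7) z₈≡0) ,
  subst (λ z → IsNeg (refl' β γ) ⇔ IsNeg z) conjugation (s-preserves-negativity {refl' β γ} (fromℕ 7) z₈≡0)
  where
  z₈≡0 = height₈-refl' β γ β₈≡0 γ₈≡0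
  conjugation : s8 (refl' β γ) ≡ refl' (s8 β) (s8 γ)
  conjugation = sym (s-conjugate (fromℕ 7) β γ)

Res-forward : ∀ {T} → All U' T → ∀ γ → Res U' T γ → Res U (ι T) (s8 γ)
Res-forward {T} uT γ (uγ , positive) =
  proj₁ (s8-U'→η⊥U γ uγ) ,
  AllP.++⁺ (AllP.map⁺ (All.zipWith (λ {β} (uβ , p) → Equivalence.to (proj₁ (reflection-sign-transfer β γ uβ uγ)) p) (uT , positive)))
           (η-positive ∷ [])
  where
  η-positive : IsPos (refl' η (s8 γ))
  η-positive = subst IsPos (sym (refl'-fixes η (s8 γ) (trans (B-sym η (s8 γ)) (proj₂ (s8-U'→η⊥U γ uγ)))))
                     (proj₁ (proj₁ (s8-U'→η⊥U γ uγ)))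

Res-backward : ∀ {T} → Ω U' T → ∀ δ → Res U (ι T) δ → ∃ λ γ → Res U' T γ × s8 γ ≡ δ
Res-backward {T} o@((_ , uT , _) , _) δ (uδ , positive) = s8 δ , (uγ , positiveT) , s8-involutive δ
  where
  split = AllP.++⁻ (mapL s8 T) positive
  positive-s8T : All (λ β → IsPos (refl' (s8 β) δ)) T
  positive-s8T = AllP.map⁻ (proj₁ split)
  orthogonal : ∀ {T} → All U' T → All (λ β → IsPos (refl' (s8 β) δ)) T → length T ≡ 3 → Orth δ η
  orthogonal (uβ ∷ _) (p ∷ _) _ = All.lookup (All.lookup residue-⊥η (U-root∈ uδ) (All.head (proj₂ split))) (U'-root∈ uβ) p
  uγ : U' (s8 δ)
  uγ = All.lookup s8-η⊥U⊆U' (U-root∈ uδ) (orthogonal uT positive-s8T (Ω-U'-length o))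
  positiveT : All (λ β → IsPos (refl' β (s8 δ))) T
  positiveT = All.zipWith (λ {β} (uβ , p) → Equivalence.from (proj₁ (reflection-sign-transfer β (s8 δ) uβ uγ))
                                              (subst (λ t → IsPos (refl' (s8 β) t)) (sym (s8-involutive δ)) p))
                          (uT , positive-s8T)

Res? : ∀ T γ → Dec (Res U' T γ)
Res? T γ = U'? γ ×-dec All.all? (λ β → IsPos? (refl' β γ)) T

Res-cardinality : ∀ {T} → Ω U' T → Σ ℕ λ n → HasCard (Res U' T) n × HasCard (Res U (ι T)) n
Res-cardinality {T} o@((_ , uT , _) , _) = length L , (L , enumL , refl) , (mapL s8 L , enum-s8L , ListP.length-map s8 L)
  where
  L = filter (Res? T) U'-roots
  ∈L⇔ : ∀ x → x ∈ L ⇔ Res U' T x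
  ∈L⇔ x = mk⇔ (proj₂ ∘ ∈P.∈-filter⁻ (Res? T) {xs = U'-roots}) (λ r → ∈P.∈-filter⁺ (Res? T) (U'-root∈ (proj₁ r)) r)
  enumL : Enumerates (Res U' T) L
  enumL = UniqueP.filter⁺ (Res? T) U'-roots-unique , ∈L⇔
  to : ∀ x → x ∈ mapL s8 L → Res U (ι T) x
  to x x∈ = from-preimage (∈P.∈-map⁻ s8 x∈)
    where
    from-preimage : (∃ λ γ → γ ∈ L × x ≡ s8 γ) → Res U (ι T) x
    from-preimage (γ , γ∈L , x≡s8γ) = subst (Res U (ι T)) (sym x≡s8γ) (Res-forward uT γ (Equivalence.to (∈L⇔ γ) γ∈L))
  from : ∀ x → Res U (ι T) x → x ∈ mapL s8 L
  from x r = to-image (Res-backward o x r)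
    where
    to-image : (∃ λ γ → Res U' T γ × s8 γ ≡ x) → x ∈ mapL s8 L
    to-image (γ , rγ , s8γ≡x) = subst (_∈ mapL s8 L) s8γ≡x (∈P.∈-map⁺ s8 (Equivalence.from (∈L⇔ γ) rγ))
  enum-s8L : Enumerates (Res U (ι T)) (mapL s8 L)
  enum-s8L = UniqueP.map⁺ (λ {x} {y} → s8-injective x y) (proj₁ enumL) , λ x → mk⇔ (to x) (from x)

≡⇒≈ˢ : ∀ {A A′} → A ≡ A′ → A ≈ˢ A′
≡⇒≈ˢ refl x = ⇔-refl

lemma5p12 :
    -- (i) s₈ restricts to a bijection U' → η^⊥_U
    ((∀ β → U' β → ηperpU (s8 β))
      × (∀ β γ → U' β → U' γ → s8 β ≡ s8 γ → β ≡ γ)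
      × (∀ δ → ηperpU δ → ∃ λ β → U' β × s8 β ≡ δ))
    -- (ii) every element of Ω_{U'} has size 3
    × (∀ T → Ω U' T → length T ≡ 3)
    -- (iii) ι is well defined, injective and W(E6)-equivariant
    × ((∀ T → Ω U' T → Ω U (ι T))
      × (∀ T T' → Ω U' T → Ω U' T' → ι T ≈ˢ ι T' → T ≈ˢ T')
      × (∀ (w : List (Fin 6)) T → Ω U' T → Ω U' (w · T) × (ι (w · T) ≈ˢ (w · ι T))))
    -- (iv) s_β(γ) < 0 iff s_{s₈β}(s₈γ) < 0, for distinct β, γ ∈ U'
    × (∀ β γ → U' β → U' γ → ¬ (β ≡ γ) → IsNeg (refl' β γ) ⇔ IsNeg (refl' (s8 β) (s8 γ)))
    -- (v) s₈ : Res_{U'}(T) → Res_U(ι T) is a bijection; ρ_{U'}(T) = ρ_U(ι T)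
    × (∀ T → Ω U' T →
        (∀ γ → Res U' T γ → Res U (ι T) (s8 γ))
        × (∀ γ γ' → Res U' T γ → Res U' T γ' → s8 γ ≡ s8 γ' → γ ≡ γ')
        × (∀ δ → Res U (ι T) δ → ∃ λ γ → Res U' T γ × s8 γ ≡ δ)
        × Σ ℕ (λ n → HasCard (Res U' T) n × HasCard (Res U (ι T)) n))
lemma5p12 =
  (s8-U'→η⊥U , (λ β γ _ _ → s8-injective β γ) , s8-η⊥U→U') ,
  (λ _ → Ω-U'-length) ,
  ((λ _ → ι-Ω) , ι-injective , λ w T o → ·-Ω w o , ≡⇒≈ˢ (ι-equivariant w (proj₁ (proj₂ (proj₁ o))))) ,
  (λ β γ uβ uγ _ → proj₂ (reflection-sign-transfer β γ uβ uγ)) ,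
  λ T o → Res-forward (proj₁ (proj₂ (proj₁ o))) , (λ γ γ′ _ _ → s8-injective γ γ′) , Res-backward o , Res-cardinality o
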